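{- Let $G=(V,E)$ be the complete graph, let $L$ be a sequence of moves and let $\tau_0\in\{\pm1\}^V$ be an initial configuration. Let $H$ be a directed acyclic graph with node set $S(L)$ that is $L$-good and $L$-neighbor-wise independent (with respect to $P_{L,\tau_0}$). Then $\mathrm{rank}(P_{L,\tau_0})\ge |E(H)|$.
   Context: A configuration is $\tau\in\{\pm1\}^V$. A sequence of moves $L$ is a finite sequence of vertices $L(1),\dots,L(\ell(L))$; $S(L)$ is the set of vertices occurring in $L$. Given $\tau_0$, $\tau_t$ is obtained from $\tau_{t-1}$ by flipping the sign of vertex $L(t)$. The matrix $M_{L,\tau_0}\in\{0,\pm1\}^{E\times[\ell(L)]}$ has $M_{L,\tau_0}[\{a,b\},t]=+1$ if $L(t)\in\{a,b\}$ and $\tau_t(a)\neq\tau_t(b)$, $-1$ if $L(t)\in\{a,b\}$ and $\tau_t(a)=\tau_t(b)$, $0$ otherwise. A pair for $v$ is $(t_1,t_2)$ with $t_1<t_2$, $L(t_1)=L(t_2)=v$ and $L(t)\ne v$ for $t_1<t<t_2$; $\Gamma(L)$ is the set of all pairs. $P_{L,\tau_0}\in\mathbb{Z}^{E\times\Gamma(L)}$ has $P_{L,\tau_0}[\{a,b\},(t_1,t_2)]:=M_{L,\tau_0}[\{a,b\},t_1]+M_{L,\tau_0}[\{a,b\},t_2]$. For $u,v\in S(L)$, the ordered pair $vu$ is an $L$-good-arc if there is a pair $C\in\Gamma(L)$ for $v$ with $P_{L,\tau_0}[\{u,v\},C]\neq0$; a directed graph on a subset of $S(L)$ is $L$-good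 if all its arcs are $L$-good-arcs. A directed graph $H$ with node set $S(L)$ is $L$-neighbor-wise independent if for every $v\in S(L)$ there is an ordering $u_1,\dots,u_m$ of the out-neighbors of $v$ in $H$ and pairs $C_1,\dots,C_m\in\Gamma(L)$ for $v$ such that $P_{L,\tau_0}[\{v,u_i\},C_i]\neq0$ for all $i$ and $P_{L,\tau_0}[\{v,u_j\},C_i]=0$ for all $j\in\{i+1,\dots,m\}$. -}

module Defs where

open import Data.Nat using (ℕ; zero; suc)
open import Data.Fin using (Fin; toℕ; _≟_) renaming (_<_ to _<ᶠ_)
open import Data.Fin as F using ()
open import Data.Bool using (Bool; true; false; not; if_then_else_)
open import Data.Integer using (ℤ; +_; -_; _+_; _*_; 0ℤ)
open import Data.List using (List; []; _∷_; length; lookup; take; foldl)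
open import Data.List.Membership.Propositional using (_∈_)
open import Data.List.Relation.Unary.All using (All)
open import Data.List.Relation.Unary.Unique.Propositional using (Unique)
open import Data.Product using (Σ; _×_; _,_; proj₁; proj₂; ∃-syntax)
open import Data.Sum using (_⊎_)
open import Data.Unit using (⊤)
open import Data.Vec using (Vec)
import Data.Vec as V
open import Relation.Nullary using (¬_; yes; no)
open import Relation.Binary.PropositionalEquality using (_≡_; _≢_)
open import Relation.Binary.Construct.Closure.Transitive using (TransClosure)
open import Function using (_⇔_)

-- Vertex set V = Fin n; G is the complete graph on V, so the edges are the
-- unordered pairs {a,b} with a ≢ b.  A configuration τ ∈ {±1}^V is a map
-- Fin n → Bool (true = +1, false = -1).
Config : ℕ → Set
Config n = Fin n → Bool

flipAt : ∀ {n} → Config n → Fin n → Config n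
flipAt τ v w with w ≟ v
... | yes _ = not (τ w)
... | no  _ = τ w

applyMoves : ∀ {n} → Config n → List (Fin n) → Config n
applyMoves τ L = foldl flipAt τ L

-- A sequence of moves L is a list; position t : Fin (length L) stands for
-- time t+1 (1-based in the paper).  τ_t is τ0 after the first t+1 moves.
τAt : ∀ {n} (L : List (Fin n)) (τ0 : Config n) → Fin (length L) → Config n
τAt L τ0 t = applyMoves τ0 (take (suc (toℕ t)) L)

InS : ∀ {n} → List (Fin n) → Fin n → Set
InS L v = v ∈ L

Mentry : ∀ {n} (L : List (Fin n)) (τ0 : Config n) → Fin n → Fin n → Fin (length L) → ℤ
Mentry L τ0 a b t with lookup L t ≟ a | lookup L t ≟ b
... | no _ | no _ = 0ℤ
... | _    | _    with τAt L τ0 t a Data.Bool.≟ τAt L τ0 t b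
...   | yes _ = - (+ 1)
...   | no  _ = + 1

record Pair {n} (L : List (Fin n)) : Set where
  constructor mkPair
  field
    t₁ t₂  : Fin (length L)
    t₁<t₂  : t₁ <ᶠ t₂
    same   : lookup L t₁ ≡ lookup L t₂
    gap    : ∀ t → t₁ <ᶠ t → t <ᶠ t₂ → lookup L t ≢ lookup L t₁
open Pair public

PairFor : ∀ {n} (L : List (Fin n)) → Pair L → Fin n → Set
PairFor L C v = lookup L (t₁ C) ≡ v

Pentry : ∀ {n} (L : List (Fin n)) (τ0 : Config n) → Fin n → Fin n → Pair L → ℤ
Pentry L τ0 a b C = Mentry L τ0 a b (t₁ C) + Mentry L τ0 a b (t₂ C)

GoodArc : ∀ {n} (L : List (Fin n)) (τ0 : Config n) → Fin n → Fin n → Set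
GoodArc L τ0 v u = InS L u × InS L v ×
  (Σ (Pair L) λ C → PairFor L C v × Pentry L τ0 u v C ≢ 0ℤ)

-- A directed graph H on node set S(L) is given by its (finite, duplicate-free)
-- list of arcs (v , u) meaning v → u, both endpoints in S(L).
record Digraph {n} (L : List (Fin n)) : Set where
  constructor mkDigraph
  field
    arcs      : List (Fin n × Fin n)
    arcsUniq  : Unique arcs
    arcsInS   : All (λ e → InS L (proj₁ e) × InS L (proj₂ e)) arcs
open Digraph public

Arc : ∀ {n} {L : List (Fin n)} → Digraph L → Fin n → Fin n → Set
Arc H v u = (v , u) ∈ arcs H

numArcs : ∀ {n} {L : List (Fin n)} → Digraph L → ℕ
numArcs H = length (arcs H)

Acyclic : ∀ {n} {L : List (Fin n)} → Digraph L → Set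
Acyclic H = ∀ v → ¬ TransClosure (Arc H) v v

IsGood : ∀ {n} (L : List (Fin n)) (τ0 : Config n) → Digraph L → Set
IsGood L τ0 H = ∀ v u → Arc H v u → GoodArc L τ0 v u

Triangular : ∀ {n} (L : List (Fin n)) (τ0 : Config n) → Fin n → List (Fin n × Pair L) → Set
Triangular L τ0 v [] = ⊤
Triangular L τ0 v ((u , C) ∷ rest) =
  PairFor L C v × Pentry L τ0 v u C ≢ 0ℤ ×
  All (λ w → Pentry L τ0 v (proj₁ w) C ≡ 0ℤ) rest ×
  Triangular L τ0 v rest

NeighborwiseIndependent : ∀ {n} (L : List (Fin n)) (τ0 : Config n) → Digraph L → Set
NeighborwiseIndependent {n} L τ0 H =
  ∀ v → InS L v →
    Σ (List (Fin n × Pair L)) λ ws →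
      Unique (Data.List.map proj₁ ws) ×
      (∀ u → (u ∈ Data.List.map proj₁ ws) ⇔ Arc H v u) ×
      Triangular L τ0 v ws

sumFin : ∀ {k} → (Fin k → ℤ) → ℤ
sumFin {zero}  f = 0ℤ
sumFin {suc k} f = f F.zero + sumFin (λ i → f (F.suc i))

-- rank(P_{L,τ0}) ≥ r : there are r columns of P that are linearly independent
-- (over ℤ, equivalently over ℚ).  Rows are the edges {a,b}, a ≢ b, of the
-- complete graph on Fin n.
RankAtLeast : ∀ {n} (L : List (Fin n)) (τ0 : Config n) → ℕ → Set
RankAtLeast {n} L τ0 r =
  Σ (Vec (Pair L) r) λ cols →
    ∀ (c : Fin r → ℤ) →
      (∀ (a b : Fin n) → a ≢ b →
         sumFin (λ i → c i * Pentry L τ0 a b (V.lookup cols i)) ≡ 0ℤ) →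
      ∀ i → c i ≡ 0ℤ

module Submission where

-- Give every arc (v , u) of H the column of P that the
-- neighbour-wise independence of H attaches to u in the triangular list of
-- v, and use the row {v , u} as the pivot row of that arc.  Order the arcs
-- lexicographically: first by their source along the (well-founded, since H
-- is acyclic) reachability order, then by decreasing position in the list of
-- the source.  In the pivot row {v , u} of an arc, a different arc (s , t)
-- contributes zero unless it is earlier in that order:
--   * s = v and t comes before u in the list of v: zero by triangularity;
--   * s = u: then s is reachable from v, so the arc is earlier;
--   * s ∉ {v , u}: its column is a pair for s, and P[{v,u}, C] = 0 for such C.
-- A square integer system which is triangular with nonzero diagonal along a
-- well-founded order has only the trivial solution, so the chosen columns
-- are linearly independent.

open import Defs
open import Data.Nat using (ℕ; zero; suc; s≤s; _∸_) renaming (_<_ to _<ℕ_)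
import Data.Nat.Properties as ℕP
open import Data.Nat.Induction using (<-wellFounded)
open import Data.Fin using (Fin; toℕ) renaming (_<_ to _<ᶠ_)
import Data.Fin as F
import Data.Fin.Properties as FP
open import Data.List using (List; []; _∷_; length; lookup; map)
open import Data.List.Membership.Propositional using (_∈_)
open import Data.List.Membership.Propositional.Properties using (∈-lookup)
import Data.List.Relation.Unary.Any as Any
open import Data.List.Relation.Unary.Any.Properties using (lookup-index; map⁻)
import Data.List.Relation.Unary.All as All
open import Data.List.Relation.Unary.AllPairs using (_∷_)
open import Data.List.Relation.Unary.Unique.Propositional using (Unique)
open import Data.Integer using (ℤ; 0ℤ; _*_; _+_)
import Data.Integer.Properties as ℤP
open import Data.Product using (_×_; _,_; proj₁; proj₂)
open import Data.Product.Relation.Binary.Lex.Strict using (×-Lex; ×-wellFounded)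
open import Data.Sum using (_⊎_; inj₁; inj₂)
open import Data.Empty using (⊥-elim)
import Data.Vec as V
import Data.Vec.Properties as VP
open import Relation.Nullary using (yes; no)
open import Relation.Binary.Core using (Rel)
open import Relation.Binary.Definitions using (tri<; tri≈; tri>)
import Relation.Binary.Construct.On as On
open import Relation.Binary.PropositionalEquality
  using (_≡_; _≢_; refl; sym; trans; cong; cong₂; subst; isEquivalence)
open import Relation.Binary.Construct.Closure.Transitive using (TransClosure; [_]; _++_)
open import Data.Fin.Induction using (spo-wellFounded)
open import Induction.WellFounded using (Acc; acc; WellFounded)
open import Function using (Equivalence)

sumFin-cong : ∀ {k} (f g : Fin k → ℤ) → (∀ i → f i ≡ g i) → sumFin f ≡ sumFin g
sumFin-cong {zero} f g f≗g = refl
sumFin-cong {suc k} f g f≗g =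
  cong₂ _+_ (f≗g F.zero)
    (sumFin-cong (λ i → f (F.suc i)) (λ i → g (F.suc i)) (λ i → f≗g (F.suc i)))

sumFin-zero : ∀ {k} (f : Fin k → ℤ) → (∀ i → f i ≡ 0ℤ) → sumFin f ≡ 0ℤ
sumFin-zero {zero} f f≗0 = refl
sumFin-zero {suc k} f f≗0 =
  cong₂ _+_ (f≗0 F.zero) (sumFin-zero (λ i → f (F.suc i)) (λ i → f≗0 (F.suc i)))

sumFin-single : ∀ {k} (f : Fin k → ℤ) (i₀ : Fin k) →
  (∀ i → i ≢ i₀ → f i ≡ 0ℤ) → sumFin f ≡ f i₀
sumFin-single {suc k} f F.zero rest≡0 =
  trans (cong (f F.zero +_) (sumFin-zero _ (λ i → rest≡0 (F.suc i) λ ())))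
        (ℤP.+-identityʳ (f F.zero))
sumFin-single {suc k} f (F.suc i₀) rest≡0 =
  trans (cong₂ _+_ (rest≡0 F.zero λ ())
                   (sumFin-single (λ i → f (F.suc i)) i₀
                      (λ i i≢i₀ → rest≡0 (F.suc i) (λ e → i≢i₀ (FP.suc-injective e)))))
        (ℤP.+-identityˡ _)

-- Induction along ≺: in row i every term except the diagonal one vanishes.
triangular-trivialKernel : ∀ {m ℓ} (_≺_ : Rel (Fin m) ℓ) → WellFounded _≺_ →
  (Q : Fin m → Fin m → ℤ) →
  (∀ i → Q i i ≢ 0ℤ) →
  (∀ i j → j ≢ i → j ≺ i ⊎ Q i j ≡ 0ℤ) →
  (c : Fin m → ℤ) → (∀ i → sumFin (λ j → c j * Q i j) ≡ 0ℤ) →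
  ∀ i → c i ≡ 0ℤ
triangular-trivialKernel _≺_ wf Q diagonal offDiagonal c solution i = go i (wf i)
  where
  go : ∀ i → Acc _≺_ i → c i ≡ 0ℤ
  go i (acc earlier) with ℤP.i*j≡0⇒i≡0∨j≡0 (c i) pivotTerm
    where
    otherTerm : ∀ j → j ≢ i → c j * Q i j ≡ 0ℤ
    otherTerm j j≢i with offDiagonal i j j≢i
    ... | inj₁ j≺i = cong (_* Q i j) (go j (earlier j≺i))
    ... | inj₂ Qij≡0 = trans (cong (c j *_) Qij≡0) (ℤP.*-zeroʳ (c j))
    pivotTerm : c i * Q i i ≡ 0ℤ
    pivotTerm = trans (sym (sumFin-single _ i otherTerm)) (solution i)
  ... | inj₁ cᵢ≡0 = cᵢ≡0
  ... | inj₂ Qᵢᵢ≡0 = ⊥-elim (diagonal i Qᵢᵢ≡0)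

unique-lookup-injective : ∀ {A : Set} (xs : List A) → Unique xs →
  ∀ i j → lookup xs i ≡ lookup xs j → i ≡ j
unique-lookup-injective (x ∷ xs) u F.zero F.zero e = refl
unique-lookup-injective (x ∷ xs) (x∉ ∷ u) F.zero (F.suc j) e =
  ⊥-elim (All.lookup x∉ (∈-lookup j) e)
unique-lookup-injective (x ∷ xs) (x∉ ∷ u) (F.suc i) F.zero e =
  ⊥-elim (All.lookup x∉ (∈-lookup i) (sym e))
unique-lookup-injective (x ∷ xs) (x∉ ∷ u) (F.suc i) (F.suc j) e =
  cong F.suc (unique-lookup-injective xs u i j e)

module _ {n : ℕ} (L : List (Fin n)) (τ0 : Config n) where

  Mentry-outside : ∀ a b t → lookup L t ≢ a → lookup L t ≢ b → Mentry L τ0 a b t ≡ 0ℤ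
  Mentry-outside a b t t≢a t≢b with lookup L t F.≟ a | lookup L t F.≟ b
  ... | yes t≡a | _       = ⊥-elim (t≢a t≡a)
  ... | no _    | yes t≡b = ⊥-elim (t≢b t≡b)
  ... | no _    | no _    = refl

  Pentry-outside : ∀ {w} a b (C : Pair L) → PairFor L C w → w ≢ a → w ≢ b →
    Pentry L τ0 a b C ≡ 0ℤ
  Pentry-outside a b C refl w≢a w≢b = cong₂ _+_
    (Mentry-outside a b (t₁ C) w≢a w≢b)
    (Mentry-outside a b (t₂ C) (λ e → w≢a (trans (same C) e)) (λ e → w≢b (trans (same C) e)))

  module _ {v : Fin n} where

    triangular-pairFor : ∀ ws → Triangular L τ0 v ws → ∀ k → PairFor L (proj₂ (lookup ws k)) v
    triangular-pairFor (w ∷ ws) (forV , _ , _ , _) F.zero = forV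
    triangular-pairFor (w ∷ ws) (_ , _ , _ , tri) (F.suc k) = triangular-pairFor ws tri k

    triangular-pivot : ∀ ws → Triangular L τ0 v ws → ∀ k →
      Pentry L τ0 v (proj₁ (lookup ws k)) (proj₂ (lookup ws k)) ≢ 0ℤ
    triangular-pivot (w ∷ ws) (_ , pivot , _ , _) F.zero = pivot
    triangular-pivot (w ∷ ws) (_ , _ , _ , tri) (F.suc k) = triangular-pivot ws tri k

    triangular-below : ∀ ws → Triangular L τ0 v ws → ∀ k' k → k' <ᶠ k →
      Pentry L τ0 v (proj₁ (lookup ws k)) (proj₂ (lookup ws k')) ≡ 0ℤ
    triangular-below (w ∷ ws) (_ , _ , later , _) F.zero (F.suc k) _ =
      All.lookup later (∈-lookup k)
    triangular-below (w ∷ ws) (_ , _ , _ , tri) (F.suc k') (F.suc k) (s≤s k'<k) =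
      triangular-below ws tri k' k k'<k

module ArcColumns {n : ℕ} {L : List (Fin n)} {τ0 : Config n} (H : Digraph L)
  (acyclic : Acyclic H) (independent : NeighborwiseIndependent L τ0 H) where

  open import Data.List.Membership.DecPropositional (F._≟_ {n}) using (_∈?_)

  -- u ⊏ v: u is reachable from v by a nonempty directed walk.  Acyclicity
  -- makes this a strict order on a finite set, hence well-founded.
  _⊏_ : Rel (Fin n) _
  u ⊏ v = TransClosure (Arc H) v u

  ⊏-wellFounded : WellFounded _⊏_
  ⊏-wellFounded = spo-wellFounded record
    { isEquivalence = isEquivalence
    ; irrefl = λ { refl cycle → acyclic _ cycle }
    ; trans = λ u⊏v v⊏w → v⊏w ++ u⊏v
    ; <-resp-≈ = (λ { refl x → x }) , (λ { refl x → x })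
    }

  -- One fixed triangular enumeration of the out-neighbours of each vertex;
  -- it must be canonical so that arcs with a common source share it.
  enum : Fin n → List (Fin n × Pair L)
  enum v with v ∈? L
  ... | yes v∈L = proj₁ (independent v v∈L)
  ... | no _ = []

  Enumerates : Fin n → List (Fin n × Pair L) → Set
  Enumerates v ws = (∀ u → Arc H v u → u ∈ map proj₁ ws) × Triangular L τ0 v ws

  enum-spec : ∀ v → v ∈ L → Enumerates v (enum v)
  enum-spec v v∈L with v ∈? L
  ... | yes p = let (_ , lists , tri) = proj₂ (independent v p)
                in (λ u arc → Equivalence.from (lists u) arc) , tri
  ... | no v∉L = ⊥-elim (v∉L v∈L)

  neighbour : ∀ v → Fin (length (enum v)) → Fin n
  neighbour v k = proj₁ (lookup (enum v) k)

  pairAt : ∀ v → Fin (length (enum v)) → Pair L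
  pairAt v k = proj₂ (lookup (enum v) k)

  -- Elimination key of the k-th entry of v: the source, then the reversed
  -- position (later entries of the same list are eliminated first).
  key : ∀ v → Fin (length (enum v)) → Fin n × ℕ
  key v k = v , length (enum v) ∸ toℕ k

  _⋖_ : Rel (Fin n × ℕ) _
  _⋖_ = ×-Lex _≡_ _⊏_ _<ℕ_

  offPivot : ∀ {v u s t} (k : Fin (length (enum v))) (k' : Fin (length (enum s))) →
    s ∈ L → Arc H v u → u ≡ neighbour v k → t ≡ neighbour s k' → (s , t) ≢ (v , u) →
    key s k' ⋖ key v k ⊎ Pentry L τ0 v u (pairAt s k') ≡ 0ℤ
  offPivot {v} {u} {s} k k' s∈L arc refl t≡nb distinct with s F.≟ v
  ... | yes refl with FP.<-cmp k' k
  ...   | tri< k'<k _ _ =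
          inj₂ (triangular-below L τ0 (enum v) (proj₂ (enum-spec v s∈L)) k' k k'<k)
  ...   | tri≈ _ refl _ = ⊥-elim (distinct (cong (v ,_) t≡nb))
  ...   | tri> _ _ k<k' = inj₁ (inj₂ (refl , ℕP.∸-monoʳ-< k<k' (ℕP.<⇒≤ (FP.toℕ<n k'))))
  offPivot {v} {u} {s} k k' s∈L arc refl t≡nb distinct | no s≢v with s F.≟ u
  ...   | yes refl = inj₁ (inj₁ [ arc ])
  ...   | no s≢u = inj₂ (Pentry-outside L τ0 v u (pairAt s k')
                          (triangular-pairFor L τ0 (enum s) (proj₂ (enum-spec s s∈L)) k')
                          s≢v s≢u)

  m : ℕ
  m = numArcs H

  src tgt : Fin m → Fin n
  src i = proj₁ (lookup (arcs H) i)
  tgt i = proj₂ (lookup (arcs H) i)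

  isArc : ∀ i → Arc H (src i) (tgt i)
  isArc i = ∈-lookup i

  src∈L : ∀ i → src i ∈ L
  src∈L i = proj₁ (All.lookup (arcsInS H) (isArc i))

  src≢tgt : ∀ i → src i ≢ tgt i
  src≢tgt i e = acyclic (src i) [ subst (Arc H (src i)) (sym e) (isArc i) ]

  position : ∀ i → Fin (length (enum (src i)))
  position i = Any.index (map⁻ (proj₁ (enum-spec (src i) (src∈L i)) (tgt i) (isArc i)))

  tgt≡neighbour : ∀ i → tgt i ≡ neighbour (src i) (position i)
  tgt≡neighbour i = lookup-index (map⁻ (proj₁ (enum-spec (src i) (src∈L i)) (tgt i) (isArc i)))

  column : Fin m → Pair L
  column i = pairAt (src i) (position i)

  Q : Fin m → Fin m → ℤ
  Q i j = Pentry L τ0 (src i) (tgt i) (column j)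

  _≺_ : Rel (Fin m) _
  j ≺ i = key (src j) (position j) ⋖ key (src i) (position i)

  ≺-wellFounded : WellFounded _≺_
  ≺-wellFounded = On.wellFounded (λ i → key (src i) (position i))
                    (×-wellFounded ⊏-wellFounded <-wellFounded)

  Q-diagonal : ∀ i → Q i i ≢ 0ℤ
  Q-diagonal i = subst (λ u → Pentry L τ0 (src i) u (column i) ≢ 0ℤ) (sym (tgt≡neighbour i))
    (triangular-pivot L τ0 (enum (src i)) (proj₂ (enum-spec (src i) (src∈L i))) (position i))

  Q-offDiagonal : ∀ i j → j ≢ i → j ≺ i ⊎ Q i j ≡ 0ℤ
  Q-offDiagonal i j j≢i = offPivot (position i) (position j) (src∈L j) (isArc i)
    (tgt≡neighbour i) (tgt≡neighbour j)
    (λ same-arc → j≢i (unique-lookup-injective (arcs H) (arcsUniq H) j i same-arc))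

lemma3p9 : (n : ℕ) (L : List (Fin n)) (τ0 : Config n) (H : Digraph L) →
    Acyclic H → IsGood L τ0 H → NeighborwiseIndependent L τ0 H →
    RankAtLeast L τ0 (numArcs H)
lemma3p9 n L τ0 H acyclic _ independent = V.tabulate column , independence
  where
  open ArcColumns H acyclic independent
  independence : ∀ (c : Fin m → ℤ) →
    (∀ (a b : Fin n) → a ≢ b →
       sumFin (λ j → c j * Pentry L τ0 a b (V.lookup (V.tabulate column) j)) ≡ 0ℤ) →
    ∀ i → c i ≡ 0ℤ
  independence c vanishes = triangular-trivialKernel _≺_ ≺-wellFounded Q Q-diagonal Q-offDiagonal c
    λ i → trans (sumFin-cong _ _ λ j → cong (λ C → c j * Pentry L τ0 (src i) (tgt i) C)
                                             (sym (VP.lookup∘tabulate column j)))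
                (vanishes (src i) (tgt i) (src≢tgt i))
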